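{- Let $n$ be an even nonnegative integer, let $\mathbf{n}=\mathbf{n}_1\cdots\mathbf{n}_r$ be the block decomposition of the minimal hyperbinary expansion $\mathbf{n}$ of $n$, and let $n_1,\ldots,n_r$ be the (even) numbers of which $\mathbf{n}_1,\ldots,\mathbf{n}_r$ are the hyperbinary expansions. Then there is a uniquely determined morphism of edge-labeled directed graphs that maps $A(n)$ isomorphically onto an induced subgraph of the Cartesian product $A(n_1)\,\Box\,\cdots\,\Box\,A(n_r)$ such that, for each vertex $\mathbf{n}'$ of $A(n)$, denoting its image by $(\mathbf{n}''_1,\ldots,\mathbf{n}''_r)$, we have $\mathbf{n}'=\mathbf{n}'_1\cdots\mathbf{n}'_r$ (concatenation), where $\mathbf{n}'_r:=\mathbf{n}''_r$ and, for each $i\in\{1,\ldots,r-1\}$, $\mathbf{n}'_i$ equals $\mathbf{n}''_i$ if $\mathbf{n}''_{i+1}$ is a short expansion, and equals $\mathbf{n}''_i$ with its last digit removed if $\mathbf{n}''_{i+1}$ is a long expansion.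
   Context: Let $\Sigma^*$ be the free monoid of finite words over the alphabet $\{0,1,2\}$ (including the empty word), with concatenation as product. A word $x_0x_1\cdots x_k\in\Sigma^*$ with $x_0\neq 0$ is a hyperbinary expansion of the nonnegative integer $\sum_{i=0}^k x_i2^{k-i}$; the empty word is the unique hyperbinary expansion of $0$. Let $\mathcal{H}(n)$ be the set of hyperbinary expansions of $n$. The edge-labeled directed graph $A(n)$ has vertex set $\mathcal{H}(n)$; its arcs are all pairs $(u,w)$ of elements of $\mathcal{H}(n)$ of one of the forms: $(\mathbf{x}02\mathbf{y},\mathbf{x}10\mathbf{y})$ or $(2\mathbf{y},10\mathbf{y})$ with $\mathbf{x},\mathbf{y}\in\Sigma^*$, labeled $\to$; or $(\mathbf{x}12\mathbf{y},\mathbf{x}20\mathbf{y})$, labeled $\twoheadrightarrow$. The minimal hyperbinary expansion of $n$ is its unique hyperbinary expansion containing no digit $0$. Every hyperbinary expansion of a positive integer $n$ has length either equal to the length of the ordinary binary expansion of $n$ (such expansions are called long) or one less (called short). A block of type $1$ is a word $1^t2$ and a block of type $2$ is a word $2^t$, for an integer $t\ge1$. The minimal hyperbinary expansion of an even number $n$ is in a unique way a product $\mathbf{n}_1\cdots\mathbf{n}_r$ ($r\ge0$) of blocks with no two consecutive blocks of type $2$; this is its block decomposition. The Cartesian product $G_1\,\Box\cdots\Box\,G_r$ of edge-labeled directed graphs has vertex set $V(G_1)\times\cdots\times V(G_r)$ and an arc from $(x_1,\ldots,x_r)$ to $(y_1,\ldots,y_r)$ whenever there is $i$ with $(x_i,y_i)$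 an arc of $G_i$ and $x_j=y_j$ for all $j\ne i$; this arc carries the label of $(x_i,y_i)$. A morphism of edge-labeled directed graphs is a vertex map sending arcs to arcs with the same label. -}

module Defs where

open import Data.Nat using (ℕ; zero; suc; _+_; _*_; _≤_; _≟_)
open import Data.Nat.Logarithm using (⌊log₂_⌋)
open import Data.List using (List; []; _∷_; _++_; foldl; length; replicate; [_])
open import Data.Vec using (Vec; lookup) renaming ([] to []ᵥ; _∷_ to _∷ᵥ_)
open import Data.Fin using (Fin)
open import Data.Product using (Σ; ∃; _×_; _,_)
open import Data.Sum using (_⊎_)
open import Data.Unit using (⊤)
open import Data.Empty using (⊥)
open import Relation.Nullary using (¬_; does; Dec)
open import Relation.Binary.PropositionalEquality using (_≡_; _≢_)
open import Data.Bool using (if_then_else_)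

data Digit : Set where
  d0 d1 d2 : Digit

Word : Set
Word = List Digit

dval : Digit → ℕ
dval d0 = 0
dval d1 = 1
dval d2 = 2

val : Word → ℕ
val = foldl (λ a d → 2 * a + dval d) 0

HeadNonZero : Word → Set
HeadNonZero []        = ⊤
HeadNonZero (d0 ∷ _)  = ⊥
HeadNonZero (d1 ∷ _)  = ⊤
HeadNonZero (d2 ∷ _)  = ⊤

IsHyp : ℕ → Word → Set
IsHyp n w = HeadNonZero w × val w ≡ n

NoZero : Word → Set
NoZero []        = ⊤
NoZero (d0 ∷ _)  = ⊥
NoZero (d1 ∷ w)  = NoZero w
NoZero (d2 ∷ w)  = NoZero w

IsMinimal : ℕ → Word → Set
IsMinimal n w = IsHyp n w × NoZero w

data Label : Set where
  arr twohead : Label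

data Step : Label → Word → Word → Set where
  s02 : ∀ x y → Step arr (x ++ d0 ∷ d2 ∷ y) (x ++ d1 ∷ d0 ∷ y)
  s2  : ∀ y → Step arr (d2 ∷ y) (d1 ∷ d0 ∷ y)
  s12 : ∀ x y → Step twohead (x ++ d1 ∷ d2 ∷ y) (x ++ d2 ∷ d0 ∷ y)

ArcA : ℕ → Label → Word → Word → Set
ArcA n ℓ u w = IsHyp n u × IsHyp n w × Step ℓ u w

IsBlock1 : Word → Set
IsBlock1 b = Σ ℕ λ t → 1 ≤ t × b ≡ replicate t d1 ++ [ d2 ]

IsBlock2 : Word → Set
IsBlock2 b = Σ ℕ λ t → 1 ≤ t × b ≡ replicate t d2

IsBlock : Word → Set
IsBlock b = IsBlock1 b ⊎ IsBlock2 b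

concatV : ∀ {r} → Vec Word r → Word
concatV []ᵥ       = []
concatV (b ∷ᵥ bs) = b ++ concatV bs

AllBlocks : ∀ {r} → Vec Word r → Set
AllBlocks []ᵥ       = ⊤
AllBlocks (b ∷ᵥ bs) = IsBlock b × AllBlocks bs

NoTwoConsecutive2 : ∀ {r} → Vec Word r → Set
NoTwoConsecutive2 []ᵥ              = ⊤
NoTwoConsecutive2 (b ∷ᵥ []ᵥ)       = ⊤
NoTwoConsecutive2 (b ∷ᵥ c ∷ᵥ bs)   =
  ¬ (IsBlock2 b × IsBlock2 c) × NoTwoConsecutive2 (c ∷ᵥ bs)

IsBlockDecomposition : ℕ → ∀ {r} → Vec Word r → Set
IsBlockDecomposition n bs =
  IsMinimal n (concatV bs) × AllBlocks bs × NoTwoConsecutive2 bs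

bitLength : ℕ → ℕ
bitLength zero    = zero
bitLength (suc m) = suc ⌊log₂ (suc m) ⌋

IsLong : Word → Set
IsLong w = length w ≡ bitLength (val w)

isLong? : (w : Word) → Dec (IsLong w)
isLong? w = length w ≟ bitLength (val w)

dropLast : Word → Word
dropLast []           = []
dropLast (x ∷ [])     = []
dropLast (x ∷ y ∷ ys) = x ∷ dropLast (y ∷ ys)

glue : ∀ {r} → Vec Word r → Word
glue []ᵥ              = []
glue (x ∷ᵥ []ᵥ)       = x
glue (x ∷ᵥ y ∷ᵥ ys)   =
  (if does (isLong? y) then dropLast x else x) ++ glue (y ∷ᵥ ys)

IsProdVertex : ∀ {r} → Vec Word r → Vec Word r → Set
IsProdVertex bs xs = ∀ i → IsHyp (val (lookup bs i)) (lookup xs i)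

ArcProd : ∀ {r} → Vec Word r → Label → Vec Word r → Vec Word r → Set
ArcProd bs ℓ xs ys =
  IsProdVertex bs xs × IsProdVertex bs ys ×
  Σ (Fin _) λ i → Step ℓ (lookup xs i) (lookup ys i) ×
                  (∀ j → j ≢ i → lookup xs j ≡ lookup ys j)

VMap : ℕ → ℕ → Set
VMap n r = (w : Word) → IsHyp n w → Vec Word r

IsGoodMap : (n : ℕ) → ∀ {r} → Vec Word r → VMap n r → Set
IsGoodMap n bs f =
  (∀ w (p : IsHyp n w) → IsProdVertex bs (f w p)) ×
  (∀ ℓ u w (p : IsHyp n u) (q : IsHyp n w) →
     ArcA n ℓ u w → ArcProd bs ℓ (f u p) (f w q)) ×
  (∀ u w (p : IsHyp n u) (q : IsHyp n w) → f u p ≡ f w q → u ≡ w) ×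
  -- reflects labeled arcs (so the image is an induced subgraph isomorphic to A(n))
  (∀ ℓ u w (p : IsHyp n u) (q : IsHyp n w) →
     ArcProd bs ℓ (f u p) (f w q) → ArcA n ℓ u w) ×
  (∀ w (p : IsHyp n w) → w ≡ glue (f w p))

{-# OPTIONS --safe #-}
-- Let b be the first block and M the concatenation of the others, L = |M|. As b ends in 2 and has no 0,
-- v = val b is even and positive, and as M begins with a block, 2^L ≤ val M ≤ 2^(L+1) − 2. Hence, reading
-- off its last L digits, an expansion w of n = v·2^L + val M is uniquely either x·t with x ∈ 𝓗(v) and
-- t ∈ 𝓗(val M) short, or x₀1s with x = x₀0 ∈ 𝓗(v) and t = 1s ∈ 𝓗(val M) long (a carry of 2^L from the low
-- part into the last digit of x). A rewriting step of w acts on exactly one of x and t, and conversely; the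
-- only step across the cut, x₀0·2s ↦ x₀1·0s, is the leading step 2s ↦ 10s of t. So w ↦ (x, t) embeds A(n)
-- as an induced subgraph of A(v) □ A(val M), and induction on the number of blocks gives the map. It is
-- unique because gluing is injective on the vertices of the product.
module Submission where

open import Defs
open import Data.Bool using (if_then_else_)
open import Data.Empty using (⊥-elim)
open import Data.Fin using () renaming (zero to fzero; suc to fsuc)
import Data.Fin.Properties as Fin
open import Data.List using ([]; _∷_; _++_; _∷ʳ_; [_]; foldl; length; replicate; take; drop; initLast; _∷ʳ′_)
open import Data.List.Properties
  using (foldl-++; length-++; length-drop; ++-assoc; ++-identityʳ; ∷-injective; ∷ʳ-injective; take++drop≡id)
open import Data.Nat using (ℕ; zero; suc; _+_; _*_; _∸_; _^_; _≤_; _<_; z≤n; s≤s; ⌊_/2⌋)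
open import Data.Nat.Divisibility using (_∣_)
open import Data.Nat.Logarithm using (⌊log₂_⌋; ⌊log₂⌋-mono-≤; ⌊log₂⌊n/2⌋⌋≡⌊log₂n⌋∸1; ⌊log₂[2^n]⌋≡n)
open import Data.Nat.Properties
open import Data.Nat.Tactic.RingSolver using (solve-∀)
open import Data.Product using (Σ; ∃; _×_; _,_; proj₁; proj₂; map₁)
open import Data.Sum using (_⊎_; inj₁; inj₂)
import Data.Sum as Sum
open import Data.Unit using (tt)
open import Data.Vec using (Vec; head; lookup) renaming ([] to []ᵥ; _∷_ to _∷ᵥ_)
open import Data.Vec.Relation.Binary.Pointwise.Extensional using (ext; Pointwise-≡⇒≡)
open import Function using (case_of_)
open import Relation.Binary.Definitions using (tri<; tri≈; tri>)
open import Relation.Binary.PropositionalEquality hiding ([_])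
open import Relation.Nullary using (¬_; yes; no; does)
open import Relation.Nullary.Decidable using (dec-true; dec-false)

-- Values of words

val-foldl : ∀ a s → foldl (λ a d → 2 * a + dval d) a s ≡ a * 2 ^ length s + val s
val-foldl a []      = sym (trans (+-identityʳ _) (*-identityʳ a))
val-foldl a (d ∷ s) = begin
  foldl _ (2 * a + dval d) s                    ≡⟨ val-foldl (2 * a + dval d) s ⟩
  (2 * a + dval d) * 2 ^ length s + val s       ≡⟨ shift a (dval d) (2 ^ length s) (val s) ⟩
  a * 2 ^ length (d ∷ s) + (dval d * 2 ^ length s + val s)
                                                ≡⟨ cong (a * 2 ^ length (d ∷ s) +_) (val-foldl (dval d) s) ⟨
  a * 2 ^ length (d ∷ s) + val (d ∷ s)          ∎
  where
  open ≡-Reasoning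
  shift : ∀ a d K V → (2 * a + d) * K + V ≡ a * (2 * K) + (d * K + V)
  shift = solve-∀

val-∷ : ∀ d s → val (d ∷ s) ≡ dval d * 2 ^ length s + val s
val-∷ d s = val-foldl (dval d) s

val-++ : ∀ p s → val (p ++ s) ≡ val p * 2 ^ length s + val s
val-++ p s = trans (foldl-++ _ 0 p s) (val-foldl (val p) s)

val-∷ʳ : ∀ p d → val (p ∷ʳ d) ≡ 2 * val p + dval d
val-∷ʳ p d = foldl-++ _ 0 p [ d ]

dval≤2 : ∀ d → dval d ≤ 2
dval≤2 d0 = z≤n
dval≤2 d1 = s≤s z≤n
dval≤2 d2 = ≤-refl

val+2≤2^suc-length : ∀ w → val w + 2 ≤ 2 ^ suc (length w)
val+2≤2^suc-length []      = ≤-refl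
val+2≤2^suc-length (d ∷ s) = begin
  val (d ∷ s) + 2               ≡⟨ cong (_+ 2) (val-∷ d s) ⟩
  dval d * K + val s + 2        ≡⟨ +-assoc (dval d * K) (val s) 2 ⟩
  dval d * K + (val s + 2)      ≤⟨ +-mono-≤ (*-monoˡ-≤ K (dval≤2 d)) (val+2≤2^suc-length s) ⟩
  2 * K + 2 * K                 ≡⟨ double (2 * K) ⟩
  2 * (2 * K)                   ∎
  where
  open ≤-Reasoning
  K = 2 ^ length s
  double : ∀ m → m + m ≡ 2 * m
  double = solve-∀

val<2^suc-length : ∀ w → val w < 2 ^ suc (length w)
val<2^suc-length w = ≤-trans (m<m+n (val w) {2} (s≤s z≤n)) (val+2≤2^suc-length w)

2^length≤val-∷ : ∀ d s → HeadNonZero (d ∷ s) → 2 ^ length s ≤ val (d ∷ s)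
2^length≤val-∷ d s hnz = begin
  2 ^ length s                   ≡⟨ *-identityˡ _ ⟨
  1 * 2 ^ length s               ≤⟨ *-monoˡ-≤ (2 ^ length s) (1≤dval d hnz) ⟩
  dval d * 2 ^ length s          ≤⟨ m≤m+n _ (val s) ⟩
  dval d * 2 ^ length s + val s  ≡⟨ val-∷ d s ⟨
  val (d ∷ s)                    ∎
  where
  open ≤-Reasoning
  1≤dval : ∀ d → HeadNonZero (d ∷ s) → 1 ≤ dval d
  1≤dval d1 _ = s≤s z≤n
  1≤dval d2 _ = s≤s z≤n

IsHyp0⇒[] : ∀ w → IsHyp 0 w → w ≡ []
IsHyp0⇒[] []      _          = refl
IsHyp0⇒[] (d ∷ s) (hnz , v≡0) =
  ⊥-elim (<⇒≱ (m^n>0 2 (length s)) (subst (2 ^ length s ≤_) v≡0 (2^length≤val-∷ d s hnz)))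

odd-last-digit : ∀ a c b → 2 * a + dval c ≡ suc (2 * b) → c ≡ d1 × a ≡ b
odd-last-digit a d0 b e = ⊥-elim (even≢odd a b (trans (sym (+-identityʳ (2 * a))) e))
odd-last-digit a d1 b e = refl , *-cancelˡ-≡ a b 2 (suc-injective (trans (+-comm 1 (2 * a)) e))
odd-last-digit a d2 b e = ⊥-elim (even≢odd (suc a) b (trans (*-suc 2 a) (trans (+-comm 2 (2 * a)) e)))

-- Binary length

2^-cancel-< : ∀ a b → 2 ^ a < 2 ^ b → a < b
2^-cancel-< a b 2^a<2^b with a <? b
... | yes a<b = a<b
... | no a≮b  = ⊥-elim (<⇒≱ 2^a<2^b (^-monoʳ-≤ 2 (≮⇒≥ a≮b)))

⌊n/2⌋<m : ∀ n m → n < m + m → ⌊ n /2⌋ < m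
⌊n/2⌋<m n zero ()
⌊n/2⌋<m zero (suc m) _ = s≤s z≤n
⌊n/2⌋<m (suc zero) (suc m) _ = s≤s z≤n
⌊n/2⌋<m (suc (suc n)) (suc m) (s≤s n<2m) =
  s≤s (⌊n/2⌋<m n m (≤-pred (subst (suc (suc n) ≤_) (+-suc m m) n<2m)))

<2^suc⇒⌊log₂⌋≤ : ∀ k n → n < 2 ^ suc k → ⌊log₂ n ⌋ ≤ k
<2^suc⇒⌊log₂⌋≤ zero zero _ = z≤n
<2^suc⇒⌊log₂⌋≤ zero (suc zero) _ = z≤n
<2^suc⇒⌊log₂⌋≤ zero (suc (suc n)) (s≤s (s≤s ()))
<2^suc⇒⌊log₂⌋≤ (suc k) n n<2^[2+k] = pred≤⇒≤suc (subst (_≤ k) (⌊log₂⌊n/2⌋⌋≡⌊log₂n⌋∸1 n) half-bound)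
  where
  half-bound : ⌊log₂ ⌊ n /2⌋ ⌋ ≤ k
  half-bound = <2^suc⇒⌊log₂⌋≤ k ⌊ n /2⌋
    (⌊n/2⌋<m n (2 ^ suc k) (subst (n <_) (cong (2 ^ suc k +_) (+-identityʳ _)) n<2^[2+k]))
  pred≤⇒≤suc : ∀ {x} → x ∸ 1 ≤ k → x ≤ suc k
  pred≤⇒≤suc {zero} _ = z≤n
  pred≤⇒≤suc {suc x} x≤k = s≤s x≤k

bitLength≡ : ∀ k n → 2 ^ k ≤ n → n < 2 ^ suc k → bitLength n ≡ suc k
bitLength≡ k zero 2^k≤0 _ = ⊥-elim (<⇒≱ (m^n>0 2 k) 2^k≤0)
bitLength≡ k (suc n) 2^k≤n n<2^[1+k] = cong suc (≤-antisym (<2^suc⇒⌊log₂⌋≤ k (suc n) n<2^[1+k])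
  (subst (_≤ ⌊log₂ suc n ⌋) (⌊log₂[2^n]⌋≡n k) (⌊log₂⌋-mono-≤ 2^k≤n)))

-- Cutting words

++-injective-length : ∀ (p p' : Word) {s s'} → length p ≡ length p' → p ++ s ≡ p' ++ s' → p ≡ p' × s ≡ s'
++-injective-length []      []        _ e = refl , e
++-injective-length (c ∷ p) (c' ∷ p') l e with ∷-injective e
... | refl , e' = map₁ (cong (c ∷_)) (++-injective-length p p' (suc-injective l) e')

++-injective : ∀ (p p' : Word) {s s'} → length s ≡ length s' → p ++ s ≡ p' ++ s' → p ≡ p' × s ≡ s'
++-injective p p' {s} {s'} ls e = ++-injective-length p p' (+-cancelʳ-≡ (length s) _ _ (begin
  length p + length s    ≡⟨ length-++ p ⟨
  length (p ++ s)        ≡⟨ cong length e ⟩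
  length (p' ++ s')      ≡⟨ length-++ p' ⟩
  length p' + length s'  ≡⟨ cong (length p' +_) ls ⟨
  length p' + length s   ∎)) e
  where open ≡-Reasoning

data Cuts (p s q r : Word) : Set where
  same     : p ≡ q → s ≡ r → Cuts p s q r
  p-before : ∀ c Z → q ≡ p ++ c ∷ Z → s ≡ c ∷ Z ++ r → Cuts p s q r
  q-before : ∀ c Z → p ≡ q ++ c ∷ Z → r ≡ c ∷ Z ++ s → Cuts p s q r

cuts : ∀ (p q : Word) {s r} → p ++ s ≡ q ++ r → Cuts p s q r
cuts []      []      e = same refl e
cuts []      (c ∷ q) e = p-before c q refl e
cuts (c ∷ p) []      e = q-before c p refl (sym e)
cuts (c ∷ p) (d ∷ q) e with ∷-injective e
... | refl , e' with cuts p q e'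
...   | same refl s≡r              = same refl s≡r
...   | p-before c' Z refl s≡c'Zr  = p-before c' Z refl s≡c'Zr
...   | q-before c' Z refl r≡c'Zs  = q-before c' Z refl r≡c'Zs

splitAt-length : ∀ k (w : Word) → k ≤ length w → ∃ λ p → ∃ λ s → w ≡ p ++ s × length s ≡ k
splitAt-length k w k≤w = take (length w ∸ k) w , drop (length w ∸ k) w ,
  sym (take++drop≡id (length w ∸ k) w) , trans (length-drop (length w ∸ k) w) (m∸[m∸n]≡n k≤w)

length-∷ʳ : ∀ (p : Word) d → length (p ∷ʳ d) ≡ suc (length p)
length-∷ʳ p d = trans (length-++ p) (+-comm (length p) 1)

nonempty-∷ʳ : ∀ (p : Word) d → 1 ≤ length (p ∷ʳ d)
nonempty-∷ʳ p d = subst (1 ≤_) (sym (length-∷ʳ p d)) (s≤s z≤n)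

dropLast-∷ʳ : ∀ (p : Word) d → dropLast (p ∷ʳ d) ≡ p
dropLast-∷ʳ []           d = refl
dropLast-∷ʳ (c ∷ [])     d = refl
dropLast-∷ʳ (c ∷ c' ∷ p) d = cong (c ∷_) (dropLast-∷ʳ (c' ∷ p) d)

length-dropLast : ∀ (p : Word) → 1 ≤ length p → suc (length (dropLast p)) ≡ length p
length-dropLast (c ∷ [])     _ = refl
length-dropLast (c ∷ c' ∷ p) _ = cong suc (length-dropLast (c' ∷ p) (s≤s z≤n))

length-dropLast-++ : ∀ (p : Word) d s → 1 ≤ length p → length (dropLast p ++ d ∷ s) ≡ length p + length s
length-dropLast-++ p d s 1≤p = begin
  length (dropLast p ++ d ∷ s)         ≡⟨ length-++ (dropLast p) ⟩
  length (dropLast p) + suc (length s) ≡⟨ +-suc (length (dropLast p)) (length s) ⟩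
  suc (length (dropLast p)) + length s ≡⟨ cong (_+ length s) (length-dropLast p 1≤p) ⟩
  length p + length s                  ∎
  where open ≡-Reasoning

HeadNonZero-++⁻ˡ : ∀ p s → HeadNonZero (p ++ s) → HeadNonZero p
HeadNonZero-++⁻ˡ []       s _ = tt
HeadNonZero-++⁻ˡ (d1 ∷ p) s _ = tt
HeadNonZero-++⁻ˡ (d2 ∷ p) s _ = tt

HeadNonZero-∷ : ∀ c xs ys → HeadNonZero (c ∷ xs) → HeadNonZero (c ∷ ys)
HeadNonZero-∷ d1 xs ys _ = tt
HeadNonZero-∷ d2 xs ys _ = tt

HeadNonZero-irrelevant : ∀ w (a b : HeadNonZero w) → a ≡ b
HeadNonZero-irrelevant []       tt tt = refl
HeadNonZero-irrelevant (d1 ∷ w) tt tt = refl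
HeadNonZero-irrelevant (d2 ∷ w) tt tt = refl

IsHyp-irrelevant : ∀ {n} w (p q : IsHyp n w) → p ≡ q
IsHyp-irrelevant w (a , e) (b , e') = cong₂ _,_ (HeadNonZero-irrelevant w a b) (≡-irrelevant e e')

-- Rewriting steps

-- Rule ℓ a a' is the rewriting a2 ↦ a'0 performed by s02 and s12.
data Rule : Label → Digit → Digit → Set where
  r02 : Rule arr d0 d1
  r12 : Rule twohead d1 d2

rule-step : ∀ {ℓ a a'} → Rule ℓ a a' → ∀ x y → Step ℓ (x ++ a ∷ d2 ∷ y) (x ++ a' ∷ d0 ∷ y)
rule-step r02 = s02
rule-step r12 = s12

data StepView : Label → Word → Word → Set where
  inner   : ∀ {ℓ a a'} → Rule ℓ a a' → ∀ x y → StepView ℓ (x ++ a ∷ d2 ∷ y) (x ++ a' ∷ d0 ∷ y)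
  leading : ∀ y → StepView arr (d2 ∷ y) (d1 ∷ d0 ∷ y)

stepView : ∀ {ℓ u w} → Step ℓ u w → StepView ℓ u w
stepView (s02 x y) = inner r02 x y
stepView (s12 x y) = inner r12 x y
stepView (s2 y)    = leading y

Step-nonempty : ∀ {ℓ u w} → Step ℓ u w → u ≢ []
Step-nonempty (s02 []      y) ()
Step-nonempty (s02 (_ ∷ _) y) ()
Step-nonempty (s12 []      y) ()
Step-nonempty (s12 (_ ∷ _) y) ()
Step-nonempty (s2 y)          ()

Step-length : ∀ {ℓ u w} → Step ℓ u w →
  length u ≡ length w ⊎ (ℓ ≡ arr × ∃ λ Y → u ≡ d2 ∷ Y × w ≡ d1 ∷ d0 ∷ Y)
Step-length st with stepView st
... | inner r x y = inj₁ (trans (length-++ x) (sym (length-++ x)))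
... | leading y   = inj₂ (refl , y , refl , refl)

Step-++ʳ : ∀ {ℓ u w} → Step ℓ u w → ∀ T → Step ℓ (u ++ T) (w ++ T)
Step-++ʳ st T with stepView st
... | inner r x y = subst₂ (Step _) (sym (++-assoc x _ T)) (sym (++-assoc x _ T)) (rule-step r x (y ++ T))
... | leading y   = s2 (y ++ T)

Step-++ˡ : ∀ {ℓ u w} → Step ℓ u w → length u ≡ length w → ∀ P → Step ℓ (P ++ u) (P ++ w)
Step-++ˡ st l P with stepView st
... | inner r x y = subst₂ (Step _) (++-assoc P x _) (++-assoc P x _) (rule-step r (P ++ x) y)
... | leading y   = ⊥-elim (1+n≢n (sym (suc-injective l)))

Step-replaceLast : ∀ {ℓ} A B c c' → Step ℓ (A ∷ʳ c) (B ∷ʳ c) → Step ℓ (A ∷ʳ c') (B ∷ʳ c')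
Step-replaceLast A B c c' st = go (stepView st) refl refl
  where
  go : ∀ {ℓ u w} → StepView ℓ u w → u ≡ A ∷ʳ c → w ≡ B ∷ʳ c → Step ℓ (A ∷ʳ c') (B ∷ʳ c')
  go (inner r x y) eu ew with initLast y
  ... | [] with ∷ʳ-injective (x ∷ʳ _) A (trans (++-assoc x _ _) eu)
               | ∷ʳ-injective (x ∷ʳ _) B (trans (++-assoc x _ _) ew)
  ...   | _ , refl | _ , ()
  go (inner r x y) eu ew | Y ∷ʳ′ e
    with ∷ʳ-injective (x ++ _ ∷ d2 ∷ Y) A (trans (++-assoc x _ [ e ]) eu)
       | ∷ʳ-injective (x ++ _ ∷ d0 ∷ Y) B (trans (++-assoc x _ [ e ]) ew)
  ... | refl , refl | refl , _ =
    subst₂ (Step _) (sym (++-assoc x _ [ c' ])) (sym (++-assoc x _ [ c' ])) (rule-step r x (Y ∷ʳ c'))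
  go (leading y) eu ew with initLast y
  ... | [] with ∷ʳ-injective [] A eu | ∷ʳ-injective [ d1 ] B ew
  ...   | _ , refl | _ , ()
  go (leading y) eu ew | Y ∷ʳ′ e with ∷ʳ-injective (d2 ∷ Y) A eu | ∷ʳ-injective (d1 ∷ d0 ∷ Y) B ew
  ... | refl , refl | refl , _ = s2 (Y ∷ʳ c')

data SplitStep (ℓ : Label) (p s p' s' : Word) : Set where
  inPrefix : Step ℓ p p' → s ≡ s' → SplitStep ℓ p s p' s'
  inSuffix : p ≡ p' → Step ℓ s s' → SplitStep ℓ p s p' s'
  across   : ∀ {a a'} P Y → Rule ℓ a a' → p ≡ P ∷ʳ a → p' ≡ P ∷ʳ a' → s ≡ d2 ∷ Y → s' ≡ d0 ∷ Y →
             SplitStep ℓ p s p' s'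

splitStep-inner : ∀ {ℓ a a'} → Rule ℓ a a' → ∀ x y p s p' s' →
  x ++ a ∷ d2 ∷ y ≡ p ++ s → x ++ a' ∷ d0 ∷ y ≡ p' ++ s' → length s ≡ length s' → SplitStep ℓ p s p' s'
splitStep-inner {a' = a'} r x y p s p' s' eu ew ls with cuts x p eu
... | same refl refl with ++-injective p' x (sym ls) (sym ew)
...   | refl , refl = inSuffix refl (rule-step r [] y)
splitStep-inner {a' = a'} r x y p s p' s' eu ew ls | q-before c Z refl refl
  with ++-injective p' p (trans (sym ls) (cong suc (trans (length-++ Z) (sym (length-++ Z)))))
                     (trans (sym ew) (++-assoc p (c ∷ Z) _))
...   | refl , refl = inSuffix refl (rule-step r (c ∷ Z) y)
splitStep-inner {a' = a'} r x y p s p' s' eu ew ls | p-before _ [] refl refl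
  with ++-injective p' (x ∷ʳ a') (sym ls) (trans (sym ew) (sym (++-assoc x [ a' ] _)))
...   | refl , refl = across x y r refl refl refl refl
splitStep-inner {a' = a'} r x y p s p' s' eu ew ls | p-before _ (_ ∷ Z) refl refl
  with ++-injective p' (x ++ a' ∷ d0 ∷ Z) (sym ls) (trans (sym ew) (sym (++-assoc x (a' ∷ d0 ∷ Z) s)))
...   | refl , refl = inPrefix (rule-step r x Z) refl

splitStep-leading : ∀ y p s p' s' → d2 ∷ y ≡ p ++ s → d1 ∷ d0 ∷ y ≡ p' ++ s' →
  length s ≡ length s' → 1 ≤ length p → SplitStep arr p s p' s'
splitStep-leading y (_ ∷ p) s p' s' eu ew ls _ with ∷-injective eu
... | refl , refl with ++-injective p' (d1 ∷ d0 ∷ p) (sym ls) (sym ew)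
...   | refl , refl = inPrefix (s2 p) refl

splitStep : ∀ {ℓ u w} → Step ℓ u w → ∀ p s p' s' → u ≡ p ++ s → w ≡ p' ++ s' →
  length s ≡ length s' → 1 ≤ length p → SplitStep ℓ p s p' s'
splitStep st p s p' s' eu ew ls 1≤p with stepView st
... | inner r x y = splitStep-inner r x y p s p' s' eu ew ls
... | leading y   = splitStep-leading y p s p' s' eu ew ls 1≤p

-- Short expansions and blocks

-- A short expansion has one digit fewer than the binary expansion of its value.
IsShort : Word → Set
IsShort w = 2 ^ length w ≤ val w

IsShort⇒HeadNonZero : ∀ w → IsShort w → HeadNonZero w
IsShort⇒HeadNonZero []       _  = tt
IsShort⇒HeadNonZero (d0 ∷ s) sh =
  ⊥-elim (<⇒≱ (val<2^suc-length s) (subst (2 ^ suc (length s) ≤_) (val-∷ d0 s) sh))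
IsShort⇒HeadNonZero (d1 ∷ s) _  = tt
IsShort⇒HeadNonZero (d2 ∷ s) _  = tt

IsShort⇒bitLength : ∀ w → IsShort w → bitLength (val w) ≡ suc (length w)
IsShort⇒bitLength w sh = bitLength≡ (length w) (val w) sh (val<2^suc-length w)

IsShort-++ : ∀ p s → IsShort p → IsShort (p ++ s)
IsShort-++ p s sh = begin
  2 ^ length (p ++ s)            ≡⟨ cong (2 ^_) (length-++ p) ⟩
  2 ^ (length p + length s)      ≡⟨ ^-distribˡ-+-* 2 (length p) (length s) ⟩
  2 ^ length p * 2 ^ length s    ≤⟨ *-monoˡ-≤ (2 ^ length s) sh ⟩
  val p * 2 ^ length s           ≤⟨ m≤m+n _ (val s) ⟩
  val p * 2 ^ length s + val s   ≡⟨ val-++ p s ⟨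
  val (p ++ s)                   ∎
  where open ≤-Reasoning

NoZero⇒2^length≤1+val : ∀ w → NoZero w → 2 ^ length w ≤ suc (val w)
NoZero⇒2^length≤1+val []       _  = ≤-refl
NoZero⇒2^length≤1+val (d1 ∷ s) nz = begin
  2 * K                      ≡⟨ cong (K +_) (+-identityʳ K) ⟩
  K + K                      ≤⟨ +-monoʳ-≤ K (NoZero⇒2^length≤1+val s nz) ⟩
  K + suc (val s)            ≡⟨ +-suc K (val s) ⟩
  suc (K + val s)            ≡⟨ cong suc (cong (_+ val s) (+-identityʳ K)) ⟨
  suc (1 * K + val s)        ≡⟨ cong suc (val-∷ d1 s) ⟨
  suc (val (d1 ∷ s))         ∎
  where
  open ≤-Reasoning
  K = 2 ^ length s
NoZero⇒2^length≤1+val (d2 ∷ s) nz = begin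
  2 * K                      ≤⟨ m≤m+n (2 * K) (val s) ⟩
  2 * K + val s              ≡⟨ val-∷ d2 s ⟨
  val (d2 ∷ s)               ≤⟨ n≤1+n _ ⟩
  suc (val (d2 ∷ s))         ∎
  where
  open ≤-Reasoning
  K = 2 ^ length s

NoZero-replicate : ∀ t {d} → d ≢ d0 → NoZero (replicate t d)
NoZero-replicate zero    _    = tt
NoZero-replicate (suc t) {d1} _ = NoZero-replicate t (λ ())
NoZero-replicate (suc t) {d2} _ = NoZero-replicate t (λ ())
NoZero-replicate (suc t) {d0} d≢0 = ⊥-elim (d≢0 refl)

replicate-suc-∷ʳ : ∀ t (d : Digit) → replicate (suc t) d ≡ replicate t d ∷ʳ d
replicate-suc-∷ʳ zero    d = refl
replicate-suc-∷ʳ (suc t) d = cong (d ∷_) (replicate-suc-∷ʳ t d)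

IsBlock⇒NoZero∷ʳ2 : ∀ b → IsBlock b → ∃ λ b₀ → NoZero b₀ × b ≡ b₀ ∷ʳ d2
IsBlock⇒NoZero∷ʳ2 b (inj₁ (t , _ , refl))     = replicate t d1 , NoZero-replicate t (λ ()) , refl
IsBlock⇒NoZero∷ʳ2 b (inj₂ (zero , () , _))
IsBlock⇒NoZero∷ʳ2 b (inj₂ (suc t , _ , refl)) =
  replicate t d2 , NoZero-replicate t (λ ()) , replicate-suc-∷ʳ t d2

val-∷ʳ2 : ∀ b₀ → val (b₀ ∷ʳ d2) ≡ 2 * suc (val b₀)
val-∷ʳ2 b₀ = trans (val-∷ʳ b₀ d2) (2a+2≡2[1+a] (val b₀))
  where
  2a+2≡2[1+a] : ∀ a → 2 * a + 2 ≡ 2 * suc a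
  2a+2≡2[1+a] = solve-∀

IsShort-∷ʳ2 : ∀ b₀ → NoZero b₀ → IsShort (b₀ ∷ʳ d2)
IsShort-∷ʳ2 b₀ nz = begin
  2 ^ length (b₀ ∷ʳ d2)     ≡⟨ cong (2 ^_) (length-∷ʳ b₀ d2) ⟩
  2 * 2 ^ length b₀         ≤⟨ *-monoʳ-≤ 2 (NoZero⇒2^length≤1+val b₀ nz) ⟩
  2 * suc (val b₀)          ≡⟨ val-∷ʳ2 b₀ ⟨
  val (b₀ ∷ʳ d2)            ∎
  where open ≤-Reasoning

IsBlock⇒IsShort : ∀ b → IsBlock b → IsShort b
IsBlock⇒IsShort b ib with IsBlock⇒NoZero∷ʳ2 b ib
... | b₀ , nz , refl = IsShort-∷ʳ2 b₀ nz

IsBlock⇒nonempty : ∀ b → IsBlock b → 1 ≤ length b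
IsBlock⇒nonempty b ib with IsBlock⇒NoZero∷ʳ2 b ib
... | b₀ , _ , refl = subst (1 ≤_) (sym (length-∷ʳ b₀ d2)) (s≤s z≤n)

IsBlock⇒val≡2[1+h] : ∀ b → IsBlock b → ∃ λ h → val b ≡ 2 * suc h
IsBlock⇒val≡2[1+h] b ib with IsBlock⇒NoZero∷ʳ2 b ib
... | b₀ , _ , refl = val b₀ , val-∷ʳ2 b₀

concatV-IsShort : ∀ {r} (bs : Vec Word (suc r)) → AllBlocks bs → IsShort (concatV bs)
concatV-IsShort (b ∷ᵥ bs) (b-block , _) = IsShort-++ b (concatV bs) (IsBlock⇒IsShort b b-block)

-- Lengths of expansions and of glued words

data ShapeBy (L : ℕ) (y : Word) : Word → Set where
  short : ∀ {t} → ¬ IsLong y → length t ≡ L → ShapeBy L y t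
  long  : ∀ {s} → IsLong y → length s ≡ L → ShapeBy L y (d1 ∷ s)

expansion-length : ∀ B d s → IsShort B → HeadNonZero (d ∷ s) → val (d ∷ s) ≡ val B →
  length (d ∷ s) ≡ length B ⊎ length s ≡ length B
expansion-length B d s sh hnz y≡B = Sum.map₁ (λ s<B → ≤-antisym s<B B≤1+s) (m≤n⇒m<n∨m≡n s≤B)
  where
  s≤B : length s ≤ length B
  s≤B = ≤-pred (2^-cancel-< (length s) (suc (length B))
          (≤-<-trans (2^length≤val-∷ d s hnz) (subst (_< 2 ^ suc (length B)) (sym y≡B) (val<2^suc-length B))))
  B≤1+s : length B ≤ suc (length s)
  B≤1+s = ≤-pred (2^-cancel-< (length B) (suc (length (d ∷ s)))
            (≤-<-trans sh (subst (_< 2 ^ suc (length (d ∷ s))) y≡B (val<2^suc-length (d ∷ s)))))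

bitLength-of-short : ∀ B y → IsShort B → val y ≡ val B → bitLength (val y) ≡ suc (length B)
bitLength-of-short B y sh y≡B = trans (cong bitLength y≡B) (IsShort⇒bitLength B sh)

expansion-shape : ∀ B y → IsShort B → IsHyp (val B) y → ShapeBy (length B) y y
expansion-shape B [] sh (_ , 0≡B) = ⊥-elim (<⇒≱ (m^n>0 2 (length B)) (subst (2 ^ length B ≤_) (sym 0≡B) sh))
expansion-shape B (d ∷ s) sh (hnz , y≡B) with expansion-length B d s sh hnz y≡B
... | inj₁ y≡B-len =
  short (λ lg → 1+n≢n (trans (sym (bitLength-of-short B (d ∷ s) sh y≡B)) (trans (sym lg) y≡B-len))) y≡B-len
expansion-shape B (d1 ∷ s) sh (hnz , y≡B) | inj₂ s≡B-len =
  long (trans (cong suc s≡B-len) (sym (bitLength-of-short B (d1 ∷ s) sh y≡B))) s≡B-len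
expansion-shape B (d2 ∷ s) sh (hnz , y≡B) | inj₂ s≡B-len = ⊥-elim (<⇒≱ (val<2^suc-length B) (begin
  2 ^ suc (length B)              ≡⟨ cong (λ k → 2 ^ suc k) s≡B-len ⟨
  2 * 2 ^ length s                ≤⟨ m≤m+n _ (val s) ⟩
  2 * 2 ^ length s + val s        ≡⟨ trans (sym (val-∷ d2 s)) y≡B ⟩
  val B                           ∎))
  where open ≤-Reasoning

dropLastIfLong : Word → Word → Word
dropLastIfLong y x = if does (isLong? y) then dropLast x else x

dropLastIfLong-short : ∀ y x → ¬ IsLong y → dropLastIfLong y x ≡ x
dropLastIfLong-short y x ¬lg = cong (if_then dropLast x else x) (dec-false (isLong? y) ¬lg)

dropLastIfLong-long : ∀ y x → IsLong y → dropLastIfLong y x ≡ dropLast x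
dropLastIfLong-long y x lg = cong (if_then dropLast x else x) (dec-true (isLong? y) lg)

dropLastIfLong-long-∷ʳ : ∀ y x₀ d → IsLong y → dropLastIfLong y (x₀ ∷ʳ d) ≡ x₀
dropLastIfLong-long-∷ʳ y x₀ d lg = trans (dropLastIfLong-long y (x₀ ∷ʳ d) lg) (dropLast-∷ʳ x₀ d)

ShapeBy-∷ : ∀ {Ly L y y' t} → 1 ≤ Ly → ShapeBy Ly y y → ShapeBy L y' t →
  ShapeBy (Ly + L) y (dropLastIfLong y' y ++ t)
ShapeBy-∷ {Ly} {L} {y} {y'} {t} 1≤Ly shy shy' = go shy shy'
  where
  after : Word → Set
  after z = ShapeBy (Ly + L) y (z ++ t)
  go : ShapeBy Ly y y → ShapeBy L y' t → after (dropLastIfLong y' y)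
  go (short ¬lg ly) (short ¬lg' lt) = subst after (sym (dropLastIfLong-short y' y ¬lg'))
    (short ¬lg (trans (length-++ y) (cong₂ _+_ ly lt)))
  go (long {s} lg ls) (short ¬lg' lt) = subst after (sym (dropLastIfLong-short y' y ¬lg'))
    (long lg (trans (length-++ s) (cong₂ _+_ ls lt)))
  go (short ¬lg ly) (long {s'} lg' ls') = subst after (sym (dropLastIfLong-long y' y lg'))
    (short ¬lg (trans (length-dropLast-++ y d1 s' (subst (1 ≤_) (sym ly) 1≤Ly)) (cong₂ _+_ ly ls')))
  go (long {[]} lg ls) (long lg' ls') = ⊥-elim (<⇒≱ 1≤Ly (≤-reflexive (sym ls)))
  go (long {c ∷ s} lg ls) (long {s'} lg' ls') = subst after (sym (dropLastIfLong-long y' y lg'))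
    (long lg (trans (length-dropLast-++ (c ∷ s) d1 s' (s≤s z≤n)) (cong₂ _+_ ls ls')))

glue-∷ : ∀ {r} x (ys : Vec Word (suc r)) → glue (x ∷ᵥ ys) ≡ dropLastIfLong (head ys) x ++ glue ys
glue-∷ x (y ∷ᵥ ys) = refl

glue-shape : ∀ {r} (bs ys : Vec Word (suc r)) → AllBlocks bs → IsProdVertex bs ys →
  ShapeBy (length (concatV bs)) (head ys) (glue ys)
glue-shape (b ∷ᵥ []ᵥ) (y ∷ᵥ []ᵥ) (ib , _) pv =
  subst (λ L → ShapeBy L y y) (cong length (sym (++-identityʳ b)))
    (expansion-shape b y (IsBlock⇒IsShort b ib) (pv fzero))
glue-shape (b ∷ᵥ bs@(_ ∷ᵥ _)) (y ∷ᵥ ys@(_ ∷ᵥ _)) (ib , abs) pv =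
  subst (λ L → ShapeBy L y (glue (y ∷ᵥ ys))) (sym (length-++ b))
    (ShapeBy-∷ (IsBlock⇒nonempty b ib) (expansion-shape b y (IsBlock⇒IsShort b ib) (pv fzero))
               (glue-shape bs ys abs (λ i → pv (fsuc i))))

-- Splitting an expansion at a block boundary

ProductStep : Label → Word → Word → Word → Word → Set
ProductStep ℓ x t x' t' = (x ≡ x' × Step ℓ t t') ⊎ (Step ℓ x x' × t ≡ t')

module TwoPieces (v h : ℕ) (v≡2[1+h] : v ≡ 2 * suc h) (M : Word) (M-short : IsShort M) where

  L m K n : ℕ
  L = length M
  m = val M
  K = 2 ^ L
  n = v * K + m

  K≤m : K ≤ m
  K≤m = M-short

  m+2≤2K : m + 2 ≤ 2 * K
  m+2≤2K = val+2≤2^suc-length M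

  val-cut : ∀ p s → length s ≡ L → val (p ++ s) ≡ val p * K + val s
  val-cut p s ls = trans (val-++ p s) (cong (λ k → val p * 2 ^ k + val s) ls)

  val-1∷ : ∀ s → length s ≡ L → val (d1 ∷ s) ≡ K + val s
  val-1∷ s ls = trans (val-∷ d1 s) (trans (cong (λ k → 1 * 2 ^ k + val s) ls) (cong (_+ val s) (*-identityˡ K)))

  val+2≤2K : ∀ s → length s ≡ L → val s + 2 ≤ 2 * K
  val+2≤2K s ls = subst (λ k → val s + 2 ≤ 2 ^ suc k) ls (val+2≤2^suc-length s)

  -- Since K ≤ m ≤ 2K − 2, the digits above the last L absorb at most one carry from below.
  high-part-cases : ∀ a S → a * K + S ≡ n → S + 2 ≤ 2 * K → (a ≡ v × S ≡ m) ⊎ (a ≡ suc v × K + S ≡ m)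
  high-part-cases a S eq S+2≤2K with <-cmp a v
  ... | tri< a<v _ _ = ⊥-elim (m+1+n≰m (a * K + S) (begin
    a * K + S + 2          ≡⟨ +-assoc (a * K) S 2 ⟩
    a * K + (S + 2)        ≤⟨ +-monoʳ-≤ (a * K) S+2≤2K ⟩
    a * K + 2 * K          ≡⟨ shift a K ⟩
    suc a * K + K          ≤⟨ +-mono-≤ (*-monoˡ-≤ K a<v) K≤m ⟩
    n                      ≡⟨ eq ⟨
    a * K + S              ∎))
    where
    open ≤-Reasoning
    shift : ∀ a K → a * K + 2 * K ≡ suc a * K + K
    shift = solve-∀
  ... | tri≈ _ refl _ = inj₁ (refl , +-cancelˡ-≡ (v * K) S m eq)
  ... | tri> _ _ v<a with m≤n⇒m<n∨m≡n v<a
  ...   | inj₂ refl = inj₂ (refl , +-cancelˡ-≡ (v * K) (K + S) m (trans (shift v K S) eq))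
    where
    shift : ∀ v K S → v * K + (K + S) ≡ suc v * K + S
    shift = solve-∀
  ...   | inj₁ 1+v<a = ⊥-elim (m+1+n≰m m (≤-trans m+2≤2K (+-cancelˡ-≤ (v * K) (2 * K) m (begin
    v * K + 2 * K          ≡⟨ shift v K ⟩
    (2 + v) * K            ≤⟨ *-monoˡ-≤ K 1+v<a ⟩
    a * K                  ≤⟨ m≤m+n (a * K) S ⟩
    a * K + S              ≡⟨ eq ⟩
    n                      ∎))))
    where
    open ≤-Reasoning
    shift : ∀ v K → v * K + 2 * K ≡ (2 + v) * K
    shift = solve-∀

  prefix-val-unique : ∀ p p' s → length s ≡ L → val (p ++ s) ≡ n → val (p' ++ s) ≡ n → val p ≡ val p'
  prefix-val-unique p p' s ls e e' = *-cancelʳ-≡ (val p) (val p') K {{m^n≢0 2 L}}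
    (+-cancelʳ-≡ (val s) _ _ (trans (sym (val-cut p s ls)) (trans e (trans (sym e') (val-cut p' s ls)))))

  L<length : ∀ w → val w ≡ n → L < length w
  L<length w w≡n = ≤-pred (2^-cancel-< (suc L) (suc (length w)) (begin-strict
    2 * K                  ≤⟨ *-monoˡ-≤ K (subst (2 ≤_) (sym v≡2[1+h]) (*-monoʳ-≤ 2 (s≤s (z≤n {h})))) ⟩
    v * K                  ≤⟨ m≤m+n (v * K) m ⟩
    n                      ≡⟨ w≡n ⟨
    val w                  <⟨ val<2^suc-length w ⟩
    2 ^ suc (length w)     ∎))
    where open ≤-Reasoning

  val≡v⇒nonempty : ∀ x → val x ≡ v → 1 ≤ length x
  val≡v⇒nonempty []      0≡v = case trans 0≡v v≡2[1+h] of λ ()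
  val≡v⇒nonempty (_ ∷ _) _ = s≤s z≤n

  odd≢v : ∀ P → val (P ∷ʳ d1) ≢ v
  odd≢v P e = even≢odd (suc h) (val P) (begin
    2 * suc h           ≡⟨ trans e v≡2[1+h] ⟨
    val (P ∷ʳ d1)       ≡⟨ val-∷ʳ P d1 ⟩
    2 * val P + 1       ≡⟨ +-comm (2 * val P) 1 ⟩
    suc (2 * val P)     ∎)
    where open ≡-Reasoning

  -- w is x followed by t, except that a long t = 1s overlaps the last digit of x, which is then 0.
  data Join (x t w : Word) : Set where
    short : length t ≡ L → w ≡ x ++ t → Join x t w
    long  : ∀ {x₀ s} → length s ≡ L → x ≡ x₀ ∷ʳ d0 → t ≡ d1 ∷ s → w ≡ x₀ ++ d1 ∷ s → Join x t w

  Factors : Word → Set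
  Factors w = ∃ λ x → ∃ λ t → IsHyp v x × IsHyp m t × Join x t w

  carry-factors : ∀ p₀ c s → HeadNonZero ((p₀ ∷ʳ c) ++ s) → length s ≡ L →
    val (p₀ ∷ʳ c) ≡ suc v → K + val s ≡ m → Factors ((p₀ ∷ʳ c) ++ s)
  carry-factors p₀ c s hnz ls p≡1+v K+s≡m
    with odd-last-digit (val p₀) c (suc h) (trans (sym (val-∷ʳ p₀ c)) (trans p≡1+v (cong suc v≡2[1+h])))
  carry-factors []       _ _ _   _  _ _     | refl , ()
  carry-factors (c₀ ∷ q) _ s hnz ls _ K+s≡m | refl , p₀≡1+h =
    c₀ ∷ q ∷ʳ d0 , d1 ∷ s , (HeadNonZero-∷ c₀ _ _ hnz , x≡v) , (tt , trans (val-1∷ s ls) K+s≡m) ,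
    long {x₀ = c₀ ∷ q} ls refl refl (++-assoc (c₀ ∷ q) [ d1 ] s)
    where
    open ≡-Reasoning
    x≡v : val (c₀ ∷ q ∷ʳ d0) ≡ v
    x≡v = begin
      val (c₀ ∷ q ∷ʳ d0)     ≡⟨ val-∷ʳ (c₀ ∷ q) d0 ⟩
      2 * val (c₀ ∷ q) + 0   ≡⟨ +-identityʳ _ ⟩
      2 * val (c₀ ∷ q)       ≡⟨ cong (2 *_) p₀≡1+h ⟩
      2 * suc h              ≡⟨ v≡2[1+h] ⟨
      v                      ∎

  factorise : ∀ w → IsHyp n w → Factors w
  factorise w (hnz , w≡n) with splitAt-length L w (<⇒≤ (L<length w w≡n))
  ... | p , s , refl , ls
    with high-part-cases (val p) (val s) (trans (sym (val-cut p s ls)) w≡n) (val+2≤2K s ls)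
  ...   | inj₁ (p≡v , s≡m) =
    p , s , (HeadNonZero-++⁻ˡ p s hnz , p≡v) ,
    (IsShort⇒HeadNonZero s (subst₂ (λ k z → 2 ^ k ≤ z) (sym ls) (sym s≡m) K≤m) , s≡m) , short ls refl
  ...   | inj₂ (p≡1+v , K+s≡m) with initLast p
  ...     | []        = case p≡1+v of λ ()
  ...     | p₀ ∷ʳ′ c  = carry-factors p₀ c s hnz ls p≡1+v K+s≡m

  Join-unique : ∀ {x t x' t' w} → Join x t w → Join x' t' w → val x ≡ v → val x' ≡ v → x ≡ x' × t ≡ t'
  Join-unique (short lt refl) (short lt' e') _ _ = ++-injective _ _ (trans lt (sym lt')) e'
  Join-unique (long ls refl refl refl) (long ls' refl refl e') _ _
    with ++-injective _ _ (cong suc (trans ls (sym ls'))) e'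
  ... | refl , refl = refl , refl
  Join-unique {x} {t} (short lt refl) (long {x₀'} {s'} ls' refl refl e') x≡v _
    with ++-injective x (x₀' ∷ʳ d1) (trans lt (sym ls')) (trans e' (sym (++-assoc x₀' [ d1 ] s')))
  ... | refl , _ = ⊥-elim (odd≢v x₀' x≡v)
  Join-unique {x' = x'} {t'} (long {x₀} {s} ls refl refl refl) (short lt' e') _ x'≡v
    with ++-injective x' (x₀ ∷ʳ d1) (trans lt' (sym ls)) (trans (sym e') (sym (++-assoc x₀ [ d1 ] s)))
  ... | refl , _ = ⊥-elim (odd≢v x₀ x'≡v)

  Join⇒glued : ∀ {x t w y} → Join x t w → ShapeBy L y t → w ≡ dropLastIfLong y x ++ t
  Join⇒glued {x} {t} {y = y} (short _ refl) (short ¬lg _) = cong (_++ t) (sym (dropLastIfLong-short y x ¬lg))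
  Join⇒glued (short lt _) (long _ ls) = ⊥-elim (1+n≢n (trans lt (sym ls)))
  Join⇒glued (long ls refl refl _) (short _ lt) = ⊥-elim (1+n≢n (trans lt (sym ls)))
  Join⇒glued {y = y} (long {x₀} {s} _ refl refl refl) (long lg _) =
    cong (_++ d1 ∷ s) (sym (dropLastIfLong-long-∷ʳ y x₀ d0 lg))

  carried-digit≡0 : ∀ x₀ c s → length s ≡ L → val (x₀ ∷ʳ c) ≡ v → val (x₀ ++ d1 ∷ s) ≡ n → c ≡ d0
  carried-digit≡0 x₀ d0 s _  _   _   = refl
  carried-digit≡0 x₀ d1 s _  x≡v _   = ⊥-elim (odd≢v x₀ x≡v)
  carried-digit≡0 x₀ d2 s ls x≡v w≡n with high-part-cases (val (x₀ ∷ʳ d1)) (val s)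
    (trans (sym (val-cut (x₀ ∷ʳ d1) s ls)) (trans (cong val (++-assoc x₀ [ d1 ] s)) w≡n)) (val+2≤2K s ls)
  ... | inj₁ (a≡v , _)   = ⊥-elim (odd≢v x₀ a≡v)
  ... | inj₂ (a≡1+v , _) = ⊥-elim (k+1≢k+3 (2 * val x₀)
    (trans (sym (val-∷ʳ x₀ d1)) (trans a≡1+v (cong suc (trans (sym x≡v) (val-∷ʳ x₀ d2))))))
    where
    k+1≢k+3 : ∀ k → k + 1 ≢ suc (k + 2)
    k+1≢k+3 (suc k) e = k+1≢k+3 k (suc-injective e)

  glued⇒Join : ∀ {x t y} → val x ≡ v → ShapeBy L y t → val (dropLastIfLong y x ++ t) ≡ n →
    Join x t (dropLastIfLong y x ++ t)
  glued⇒Join {x} {t} {y} _ (short ¬lg lt) _ = short lt (cong (_++ t) (dropLastIfLong-short y x ¬lg))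
  glued⇒Join {x} {y = y} x≡v (long {s} lg ls) w≡n with initLast x
  ... | []       = case val≡v⇒nonempty [] x≡v of λ ()
  ... | x₀ ∷ʳ′ c with carried-digit≡0 x₀ c s ls x≡v
                        (subst (λ z → val (z ++ d1 ∷ s) ≡ n) (dropLastIfLong-long-∷ʳ y x₀ c lg) w≡n)
  ...   | refl = long ls refl refl (cong (_++ d1 ∷ s) (dropLastIfLong-long-∷ʳ y x₀ d0 lg))

  step-short-short : ∀ {ℓ} xu tu xw tw → Step ℓ (xu ++ tu) (xw ++ tw) → length tu ≡ L → length tw ≡ L →
    val xu ≡ v → val xw ≡ v → HeadNonZero tw → ProductStep ℓ xu tu xw tw
  step-short-short xu tu xw tw st ltu ltw xu≡v xw≡v hnz
    with splitStep st xu tu xw tw refl refl (trans ltu (sym ltw)) (val≡v⇒nonempty xu xu≡v)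
  ... | inPrefix st' e             = inj₂ (st' , e)
  ... | inSuffix e st'             = inj₁ (e , st')
  ... | across P Y r02 _ refl _ _  = ⊥-elim (odd≢v P xw≡v)
  ... | across P Y r12 _ _ _ refl  = ⊥-elim hnz

  step-long-long : ∀ {ℓ} x₀u su x₀w sw → Step ℓ (x₀u ++ d1 ∷ su) (x₀w ++ d1 ∷ sw) →
    length su ≡ L → length sw ≡ L → ProductStep ℓ (x₀u ∷ʳ d0) (d1 ∷ su) (x₀w ∷ʳ d0) (d1 ∷ sw)
  step-long-long x₀u su x₀w sw st lsu lsw
    with splitStep st (x₀u ∷ʳ d1) su (x₀w ∷ʳ d1) sw (sym (++-assoc x₀u _ su)) (sym (++-assoc x₀w _ sw))
               (trans lsu (sym lsw)) (nonempty-∷ʳ x₀u d1)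
  ... | inPrefix st' refl = inj₂ (Step-replaceLast x₀u x₀w d1 d0 st' , refl)
  ... | inSuffix e st' with ∷ʳ-injective x₀u x₀w e
  ...   | refl , _ = inj₁ (refl , Step-++ˡ st' (trans lsu (sym lsw)) [ d1 ])
  step-long-long x₀u su x₀w sw st lsu lsw | across P Y r02 e _ _ _ with ∷ʳ-injective x₀u P e
  ... | _ , ()
  step-long-long x₀u su x₀w sw st lsu lsw | across P Y r12 _ e _ _ with ∷ʳ-injective x₀w P e
  ... | _ , ()

  step-short-long : ∀ {ℓ} xu tu x₀w sw → Step ℓ (xu ++ tu) (x₀w ++ d1 ∷ sw) → length tu ≡ L → length sw ≡ L →
    val (xu ++ tu) ≡ n → val (x₀w ++ d1 ∷ sw) ≡ n → val xu ≡ v → ProductStep ℓ xu tu (x₀w ∷ʳ d0) (d1 ∷ sw)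
  step-short-long xu tu x₀w sw st ltu lsw u≡n w≡n xu≡v
    with splitStep st xu tu (x₀w ∷ʳ d1) sw refl (sym (++-assoc x₀w _ sw)) (trans ltu (sym lsw))
                   (val≡v⇒nonempty xu xu≡v)
  ... | inPrefix _ refl = ⊥-elim (odd≢v x₀w (trans (sym (prefix-val-unique xu (x₀w ∷ʳ d1) tu ltu u≡n
                                     (trans (cong val (++-assoc x₀w _ tu)) w≡n))) xu≡v))
  ... | inSuffix refl _ = ⊥-elim (odd≢v x₀w xu≡v)
  ... | across P Y r12 _ e _ _ with ∷ʳ-injective x₀w P e
  ...   | _ , ()
  step-short-long xu tu x₀w sw st ltu lsw u≡n w≡n xu≡v | across P Y r02 refl e refl refl
    with ∷ʳ-injective x₀w P e
  ... | refl , _ = inj₁ (refl , s2 Y)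

  step-long-short : ∀ {ℓ} x₀u su xw tw → Step ℓ (x₀u ++ d1 ∷ su) (xw ++ tw) → length su ≡ L → length tw ≡ L →
    val (x₀u ++ d1 ∷ su) ≡ n → val (xw ++ tw) ≡ n → val xw ≡ v → HeadNonZero tw →
    ProductStep ℓ (x₀u ∷ʳ d0) (d1 ∷ su) xw tw
  step-long-short x₀u su xw tw st lsu ltw u≡n w≡n xw≡v hnz
    with splitStep st (x₀u ∷ʳ d1) su xw tw (sym (++-assoc x₀u _ su)) refl (trans lsu (sym ltw))
                   (nonempty-∷ʳ x₀u d1)
  ... | inPrefix _ refl = ⊥-elim (odd≢v x₀u (trans (prefix-val-unique (x₀u ∷ʳ d1) xw su lsu
                                     (trans (cong val (++-assoc x₀u _ su)) u≡n) w≡n) xw≡v))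
  ... | inSuffix refl _ = ⊥-elim (odd≢v x₀u xw≡v)
  ... | across P Y r12 _ _ _ refl = ⊥-elim hnz
  ... | across P Y r02 e _ _ _ with ∷ʳ-injective x₀u P e
  ...   | _ , ()

  Join-step⇒ : ∀ {ℓ xu tu u xw tw w} → Join xu tu u → Join xw tw w → Step ℓ u w → val u ≡ n → val w ≡ n →
    val xu ≡ v → val xw ≡ v → HeadNonZero tw → ProductStep ℓ xu tu xw tw
  Join-step⇒ (short ltu refl) (short ltw refl) st _ _ xu≡v xw≡v hnz =
    step-short-short _ _ _ _ st ltu ltw xu≡v xw≡v hnz
  Join-step⇒ (long lsu refl refl refl) (long lsw refl refl refl) st _ _ _ _ _ =
    step-long-long _ _ _ _ st lsu lsw
  Join-step⇒ (short ltu refl) (long lsw refl refl refl) st u≡n w≡n xu≡v _ _ =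
    step-short-long _ _ _ _ st ltu lsw u≡n w≡n xu≡v
  Join-step⇒ (long lsu refl refl refl) (short ltw refl) st u≡n w≡n _ xw≡v hnz =
    step-long-short _ _ _ _ st lsu ltw u≡n w≡n xw≡v hnz

  Join-step⇐ : ∀ {ℓ xu tu u xw tw w} → Join xu tu u → Join xw tw w → ProductStep ℓ xu tu xw tw → Step ℓ u w
  Join-step⇐ (short _ refl) (short _ refl) (inj₂ (st , refl)) = Step-++ʳ st _
  Join-step⇐ (short ltu refl) (short ltw refl) (inj₁ (refl , st)) = Step-++ˡ st (trans ltu (sym ltw)) _
  Join-step⇐ (long {x₀u} {su} _ refl refl refl) (long {x₀w} _ refl refl refl) (inj₂ (st , refl)) =
    subst₂ (Step _) (++-assoc x₀u _ su) (++-assoc x₀w _ su) (Step-++ʳ (Step-replaceLast x₀u x₀w d0 d1 st) su)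
  Join-step⇐ (long {x₀u} lsu refl refl refl) (long {x₀w} lsw refl refl refl) (inj₁ (e , st))
    with ∷ʳ-injective x₀u x₀w e
  ... | refl , _ = Step-++ˡ st (cong suc (trans lsu (sym lsw))) x₀u
  Join-step⇐ (short ltu _) (long lsw _ refl _) (inj₂ (_ , refl)) = ⊥-elim (1+n≢n (trans ltu (sym lsw)))
  Join-step⇐ (long lsu _ refl _) (short ltw _) (inj₂ (_ , refl)) = ⊥-elim (1+n≢n (trans ltw (sym lsu)))
  Join-step⇐ (short ltu refl) (long {x₀w} lsw refl refl refl) (inj₁ (refl , st)) with Step-length st
  ... | inj₁ l = ⊥-elim (1+n≢n (trans (sym l) (trans ltu (sym lsw))))
  ... | inj₂ (refl , Y , refl , refl) =
    subst (λ u → Step arr u (x₀w ++ d1 ∷ d0 ∷ Y)) (sym (++-assoc x₀w _ _)) (s02 x₀w Y)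
  Join-step⇐ (long lsu refl refl refl) (short ltw refl) (inj₁ (refl , st)) with Step-length st
  ... | inj₁ l = ⊥-elim (1+n≢n (trans l (trans ltw (sym lsu))))
  ... | inj₂ (_ , _ , () , _)

-- The embedding

-- The last field, stronger than injectivity, is what carries the uniqueness of the map through the induction.
record Embedding {r} (bs : Vec Word r) : Set where
  field
    embed         : VMap (val (concatV bs)) r
    isGoodMap     : IsGoodMap (val (concatV bs)) bs embed
    unglue-unique : ∀ w p xs → IsProdVertex bs xs → w ≡ glue xs → xs ≡ embed w p

  vertex : ∀ w p → IsProdVertex bs (embed w p)
  vertex = proj₁ isGoodMap

  morphism : ∀ ℓ u w p q → ArcA (val (concatV bs)) ℓ u w → ArcProd bs ℓ (embed u p) (embed w q)
  morphism = proj₁ (proj₂ isGoodMap)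

  reflects : ∀ ℓ u w p q → ArcProd bs ℓ (embed u p) (embed w q) → ArcA (val (concatV bs)) ℓ u w
  reflects = proj₁ (proj₂ (proj₂ (proj₂ isGoodMap)))

  unglue-embed : ∀ w p → w ≡ glue (embed w p)
  unglue-embed = proj₂ (proj₂ (proj₂ (proj₂ isGoodMap)))

  embed-irrelevant : ∀ t (p p' : IsHyp (val (concatV bs)) t) → embed t p ≡ embed t p'
  embed-irrelevant t p p' = cong (embed t) (IsHyp-irrelevant t p p')

embedding-[] : Embedding []ᵥ
embedding-[] = record
  { embed         = λ _ _ → []ᵥ
  ; isGoodMap     = (λ _ _ ()) , morphism , injective , (λ { _ _ _ _ _ (_ , _ , () , _) }) , IsHyp0⇒[]
  ; unglue-unique = λ { _ _ []ᵥ _ _ → refl }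
  }
  where
  morphism : ∀ ℓ u w p q → ArcA 0 ℓ u w → ArcProd []ᵥ ℓ []ᵥ []ᵥ
  morphism ℓ u w p q (_ , _ , st) = ⊥-elim (Step-nonempty st (IsHyp0⇒[] u p))
  injective : ∀ u w (p : IsHyp 0 u) (q : IsHyp 0 w) → []ᵥ ≡ []ᵥ → u ≡ w
  injective u w p q _ = trans (IsHyp0⇒[] u p) (sym (IsHyp0⇒[] w q))

embedding-[_] : ∀ b → Embedding (b ∷ᵥ []ᵥ)
embedding-[ b ] = record
  { embed         = λ w _ → w ∷ᵥ []ᵥ
  ; isGoodMap     = vertex , morphism , (λ { u w p q refl → refl })
                  , (λ { ℓ u w p q (_ , _ , fzero , st , _) → p , q , st }) , (λ _ _ → refl)
  ; unglue-unique = λ { w p (x ∷ᵥ []ᵥ) _ refl → refl }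
  }
  where
  N = val (b ++ [])
  vertex : ∀ w → IsHyp N w → IsProdVertex (b ∷ᵥ []ᵥ) (w ∷ᵥ []ᵥ)
  vertex w (hnz , w≡N) fzero = hnz , trans w≡N (cong val (++-identityʳ b))
  morphism : ∀ ℓ u w p q → ArcA N ℓ u w → ArcProd (b ∷ᵥ []ᵥ) ℓ (u ∷ᵥ []ᵥ) (w ∷ᵥ []ᵥ)
  morphism ℓ u w p q (_ , _ , st) = vertex u p , vertex w q , fzero , st , λ { fzero 0≢0 → ⊥-elim (0≢0 refl) }

module Extension {r} (b : Word) (bs : Vec Word (suc r)) (b-block : IsBlock b) (bs-blocks : AllBlocks bs)
                 (E : Embedding bs) where

  module E = Embedding E

  M : Word
  M = concatV bs

  open TwoPieces (val b) (proj₁ (IsBlock⇒val≡2[1+h] b b-block)) (proj₂ (IsBlock⇒val≡2[1+h] b b-block))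
                 M (concatV-IsShort bs bs-blocks)

  N : ℕ
  N = val (b ++ M)

  to-n : ∀ {w} → IsHyp N w → IsHyp n w
  to-n (hnz , w≡N) = hnz , trans w≡N (val-++ b M)

  factors : ∀ w → IsHyp N w → Factors w
  factors w p = factorise w (to-n p)

  image : ∀ {w} → Factors w → Vec Word (suc (suc r))
  image (x , t , _ , ht , _) = x ∷ᵥ E.embed t ht

  ∷-vertex : ∀ {x t} → IsHyp (val b) x → (ht : IsHyp m t) → IsProdVertex (b ∷ᵥ bs) (x ∷ᵥ E.embed t ht)
  ∷-vertex         hx ht fzero    = hx
  ∷-vertex {t = t} hx ht (fsuc i) = E.vertex t ht i

  image-vertex : ∀ {w} (F : Factors w) → IsProdVertex (b ∷ᵥ bs) (image F)
  image-vertex (_ , _ , hx , ht , _) = ∷-vertex hx ht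

  shape : ∀ t ht → ShapeBy L (head (E.embed t ht)) t
  shape t ht = subst (ShapeBy L _) (sym (E.unglue-embed t ht))
                     (glue-shape bs (E.embed t ht) bs-blocks (E.vertex t ht))

  image-glue : ∀ {w} (F : Factors w) → w ≡ glue (image F)
  image-glue {w} (x , t , _ , ht , J) = begin
    w                                           ≡⟨ Join⇒glued J (shape t ht) ⟩
    dropLastIfLong (head ys) x ++ t             ≡⟨ cong (dropLastIfLong (head ys) x ++_) (E.unglue-embed t ht) ⟩
    dropLastIfLong (head ys) x ++ glue ys       ≡⟨ glue-∷ x ys ⟨
    glue (x ∷ᵥ ys)                              ∎
    where
    open ≡-Reasoning
    ys = E.embed t ht

  product⇒arc : ∀ {ℓ xu tu xw tw} (hxu : IsHyp (val b) xu) (hxw : IsHyp (val b) xw) htu htw →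
    ProductStep ℓ xu tu xw tw → ArcProd (b ∷ᵥ bs) ℓ (xu ∷ᵥ E.embed tu htu) (xw ∷ᵥ E.embed tw htw)
  product⇒arc {tu = tu} {tw = tw} hxu hxw htu htw (inj₁ (refl , st))
    with E.morphism _ tu tw htu htw (htu , htw , st)
  ... | _ , _ , i , st-i , others =
    ∷-vertex hxu htu , ∷-vertex hxw htw ,
    fsuc i , st-i , λ { fzero _ → refl ; (fsuc j) j≢i → others j (λ j≡i → j≢i (cong fsuc j≡i)) }
  product⇒arc {tu = t} hxu hxw htu htw (inj₂ (st , refl)) =
    ∷-vertex hxu htu , ∷-vertex hxw htw , fzero , st ,
    λ { fzero 0≢0 → ⊥-elim (0≢0 refl) ; (fsuc j) _ → cong (λ ys → lookup ys j) (E.embed-irrelevant t htu htw) }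

  arc⇒product : ∀ {ℓ xu tu xw tw} htu htw →
    ArcProd (b ∷ᵥ bs) ℓ (xu ∷ᵥ E.embed tu htu) (xw ∷ᵥ E.embed tw htw) → ProductStep ℓ xu tu xw tw
  arc⇒product {tu = tu} {tw = tw} htu htw (_ , _ , fzero , st , others) =
    inj₂ (st , trans (E.unglue-embed tu htu) (trans (cong glue same-tail) (sym (E.unglue-embed tw htw))))
    where
    same-tail : E.embed tu htu ≡ E.embed tw htw
    same-tail = Pointwise-≡⇒≡ (ext λ j → others (fsuc j) (λ ()))
  arc⇒product {tu = tu} {tw = tw} htu htw (pu , pw , fsuc i , st , others) =
    inj₁ (others fzero (λ ()) , proj₂ (proj₂ (E.reflects _ tu tw htu htw
      ((λ j → pu (fsuc j)) , (λ j → pw (fsuc j)) , i , st ,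
       λ j j≢i → others (fsuc j) (λ e → j≢i (Fin.suc-injective e))))))

  glue-Join : ∀ {x ys} → IsProdVertex (b ∷ᵥ bs) (x ∷ᵥ ys) → val (glue (x ∷ᵥ ys)) ≡ n →
    Join x (glue ys) (glue (x ∷ᵥ ys))
  glue-Join {x} {ys} pv w≡n = subst (Join x (glue ys)) (sym (glue-∷ x ys))
    (glued⇒Join (proj₂ (pv fzero)) (glue-shape bs ys bs-blocks (λ i → pv (fsuc i)))
                (trans (cong val (sym (glue-∷ x ys))) w≡n))

  image-unique : ∀ {w} (F : Factors w) → val w ≡ n →
    ∀ xs → IsProdVertex (b ∷ᵥ bs) xs → w ≡ glue xs → xs ≡ image F
  image-unique (x* , t* , hx* , ht* , J*) w≡n (x ∷ᵥ ys) pv refl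
    with Join-unique (glue-Join pv w≡n) J* (proj₂ (pv fzero)) (proj₂ hx*)
  ... | refl , glue≡t* = cong (x ∷ᵥ_) (E.unglue-unique t* ht* ys (λ i → pv (fsuc i)) (sym glue≡t*))

  image-arc : ∀ {ℓ u w} (Fu : Factors u) (Fw : Factors w) → val u ≡ n → val w ≡ n → Step ℓ u w →
    ArcProd (b ∷ᵥ bs) ℓ (image Fu) (image Fw)
  image-arc (_ , _ , hxu , htu , Ju) (_ , _ , hxw , htw , Jw) u≡n w≡n st =
    product⇒arc hxu hxw htu htw (Join-step⇒ Ju Jw st u≡n w≡n (proj₂ hxu) (proj₂ hxw) (proj₁ htw))

  image-arc⁻¹ : ∀ {ℓ u w} (Fu : Factors u) (Fw : Factors w) → ArcProd (b ∷ᵥ bs) ℓ (image Fu) (image Fw) →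
    Step ℓ u w
  image-arc⁻¹ (_ , _ , _ , htu , Ju) (_ , _ , _ , htw , Jw) a = Join-step⇐ Ju Jw (arc⇒product htu htw a)

  embedding : Embedding (b ∷ᵥ bs)
  embedding = record
    { embed         = λ w p → image (factors w p)
    ; isGoodMap     = (λ w p → image-vertex (factors w p))
                    , (λ ℓ u w p q (_ , _ , st) →
                         image-arc (factors u p) (factors w q) (proj₂ (to-n p)) (proj₂ (to-n q)) st)
                    , (λ u w p q e → trans (image-glue (factors u p))
                                       (trans (cong glue e) (sym (image-glue (factors w q)))))
                    , (λ ℓ u w p q a → p , q , image-arc⁻¹ (factors u p) (factors w q) a)
                    , (λ w p → image-glue (factors w p))
    ; unglue-unique = λ w p → image-unique (factors w p) (proj₂ (to-n p))
    }

embedding : ∀ {r} (bs : Vec Word r) → AllBlocks bs → Embedding bs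
embedding []ᵥ                     _          = embedding-[]
embedding (b ∷ᵥ []ᵥ)              _          = embedding-[ b ]
embedding (b ∷ᵥ bs@(_ ∷ᵥ _)) (b-block , bs-blocks) =
  Extension.embedding b bs b-block bs-blocks (embedding bs bs-blocks)

mainTheorem3 : (n : ℕ) → 2 ∣ n → (r : ℕ) (bs : Vec Word r) →
    IsBlockDecomposition n bs →
    Σ (VMap n r) λ f → IsGoodMap n bs f ×
      ((g : VMap n r) → IsGoodMap n bs g → ∀ w p → g w p ≡ f w p)
mainTheorem3 .(val (concatV bs)) _ r bs (((_ , refl) , _) , blocks , _) =
  embed , isGoodMap ,
  λ g (g-vertex , _ , _ , _ , g-glue) w p → unglue-unique w p (g w p) (g-vertex w p) (g-glue w p)
  where open Embedding (embedding bs blocks)
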